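{- Let $k\ge1$ and $1\le l,m\le k$ be integers, and let $c^{(k)}_{l,m}$ be the coefficient of $x^{\underline{l}}y^{\underline{m}}$ in the unique expansion $(xy)^{\underline{k}} = \sum_{l,m=1}^k c^{(k)}_{l,m}\, x^{\underline{l}}\, y^{\underline{m}}$. Then the number of $k$-conjoint ranking tables of size $l\times m$ equals $l!\,m!\,c^{(k)}_{l,m}$.
   Context: $x^{\underline{n}}=x(x-1)\cdots(x-n+1)$ is the falling factorial power. A $k$-conjoint ranking table of size $l\times m$ is an $l\times m$ array of cells in which each of the numbers $1,2,\dots,k$ is placed in exactly one cell, distinct numbers in distinct cells, the remaining cells left blank, such that every row and every column contains at least one number. -}

module Defs where

open import Data.Nat using (ℕ; zero; suc; _*_; _∸_)
open import Data.Integer as ℤ using (ℤ)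
open import Data.Fin using (Fin)
open import Data.Fin.Properties using (any?; all?)
import Data.Fin.Properties as FinP
open import Data.Product using (_×_; _,_; proj₁; proj₂; ∃)
open import Data.Product.Properties using (≡-dec)
open import Data.List using (List; []; _∷_; map; concatMap; length; filter; allFin; cartesianProduct)
open import Data.Vec using (Vec; lookup) renaming ([] to []ᵥ; _∷_ to _∷ᵥ_)
open import Relation.Binary.PropositionalEquality using (_≡_)
open import Relation.Nullary using (Dec)
open import Relation.Nullary.Decidable using (_×-dec_; _→-dec_)

-- falling factorial power  x^{\underline n} = x (x-1) ... (x-n+1)  evaluated at a natural x
-- (for x < n one factor is x ∸ x = 0, so this agrees with the integer value 0)
fall : ℕ → ℕ → ℕ
fall x zero    = 1
fall x (suc n) = fall x n * (x ∸ n)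

sum1 : ℕ → (ℕ → ℤ) → ℤ
sum1 zero    f = ℤ.+ 0
sum1 (suc n) f = sum1 n f ℤ.+ f (suc n)

Cell : ℕ → ℕ → Set
Cell l m = Fin l × Fin m

-- A placement of the numbers 1..k: entry i of the vector is the cell holding number i+1.
-- It is a k-conjoint ranking table when distinct numbers are in distinct cells and
-- every row and every column contains at least one number.
IsConjointTable : ∀ k l m → Vec (Cell l m) k → Set
IsConjointTable k l m v =
  (∀ (i j : Fin k) → lookup v i ≡ lookup v j → i ≡ j)
  × (∀ (r : Fin l) → ∃ λ (a : Fin k) → proj₁ (lookup v a) ≡ r)
  × (∀ (c : Fin m) → ∃ λ (a : Fin k) → proj₂ (lookup v a) ≡ c)

isConjointTable? : ∀ k l m (v : Vec (Cell l m) k) → Dec (IsConjointTable k l m v)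
isConjointTable? k l m v =
  all? (λ i → all? (λ j → ≡-dec FinP._≟_ FinP._≟_ (lookup v i) (lookup v j) →-dec (i FinP.≟ j)))
  ×-dec all? (λ r → any? (λ a → proj₁ (lookup v a) FinP.≟ r))
  ×-dec all? (λ c → any? (λ a → proj₂ (lookup v a) FinP.≟ c))

allVecs : {A : Set} → List A → (k : ℕ) → List (Vec A k)
allVecs xs zero    = []ᵥ ∷ []
allVecs xs (suc k) = concatMap (λ x → map (x ∷ᵥ_) (allVecs xs k)) xs

numTables : ℕ → ℕ → ℕ → ℕ
numTables k l m =
  length (filter (isConjointTable? k l m) (allVecs (cartesianProduct (allFin l) (allFin m)) k))

module Submission where

-- Placing 1, …, k in distinct cells of an a × b grid can be done in (ab)^{\underline k} ways. Grouping the
-- placements by the set R of occupied rows and the set S of occupied columns, each group is a set of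
-- k-conjoint tables on R × S, and its size depends only on |R| and |S|, since it obeys a recurrence in k
-- involving only these sizes. Hence (ab)^{\underline k} = Σ_{l,m} C(a,l) C(b,m) T(k,l,m) with T the number of
-- k-conjoint l × m tables, and x^{\underline l} = l! C(x,l). The binomials C(a,i), 1 ≤ i ≤ k, are triangular
-- on 0 ≤ a ≤ k, so a coefficient family is determined by the values of its expansion at 0 ≤ a, b ≤ k.

open import Defs
open import Data.Bool using (Bool; true; false; _∧_; _∨_; not)
import Data.Bool.Properties as Boolₚ
open import Data.Empty using (⊥-elim)
open import Data.Fin using (Fin; zero; suc; _≟_)
import Data.Fin.Properties as Finₚ
open import Data.Fin.Subset using (Subset; ⊥; ⊤; ∣_∣)
open import Data.Fin.Subset.Properties using (∣⊤∣≡n)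
open import Data.Integer as ℤ using (ℤ)
import Data.Integer.Properties as ℤₚ
open import Data.Integer.Tactic.RingSolver as ℤSolver using ()
open import Data.List using (List; []; _∷_; _++_; map; concatMap; allFin; cartesianProduct; length; filter)
open import Data.List.Properties using (map-tabulate)
open import Data.Nat as ℕ using (ℕ; zero; suc; _+_; _*_; _∸_; _≤_; _<_; _!; _≡ᵇ_; z≤n; s≤s)
open import Data.Nat.Combinatorics using (_C_; _P_; nCn≡1; nCk≡nPk/k!; nCk+nC[k+1]≡[n+1]C[k+1])
open import Data.Nat.Combinatorics.Base using (_P′_)
open import Data.Nat.Combinatorics.Specification using (k>n⇒nCk≡0; k!∣nP′k)
open import Data.Nat.DivMod using (_/_; m*[n/m]≡n)
open import Data.Nat.Properties hiding (_≟_)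
open import Data.Nat.Tactic.RingSolver using (solve-∀)
open import Algebra.Properties.CommutativeSemigroup +-commutativeSemigroup using () renaming (interchange to +-interchange)
import Algebra.Properties.CommutativeSemigroup ℤₚ.+-commutativeSemigroup as ℤ+
open import Data.Product using (_×_; _,_; proj₁; proj₂; ∃)
open import Data.Sum using (_⊎_; inj₁; inj₂)
open import Data.Vec using (Vec; lookup) renaming ([] to []ᵥ; _∷_ to _∷ᵥ_)
import Data.Vec.Properties as Vecₚ
open import Function using (_∘_; id; _⇔_; mk⇔; Equivalence)
open import Relation.Binary.PropositionalEquality
open import Relation.Nullary using (Dec; yes; no; does)
open import Relation.Nullary.Decidable using (dec-true)

𝟙 : Bool → ℕ
𝟙 true  = 1
𝟙 false = 0

𝟙-∧ : ∀ a b → 𝟙 (a ∧ b) ≡ 𝟙 a * 𝟙 b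
𝟙-∧ true  b = sym (+-identityʳ (𝟙 b))
𝟙-∧ false b = refl

∧-true : ∀ {a b} → a ∧ b ≡ true → a ≡ true × b ≡ true
∧-true {true} {true} _ = refl , refl

does≡true⇒ : ∀ {P : Set} (p? : Dec P) → does p? ≡ true → P
does≡true⇒ (yes p) _ = p

does≡ : ∀ {P : Set} (p? : Dec P) {b} → P ⇔ b ≡ true → does p? ≡ b
does≡ (yes p) {b}     P⇔b = sym (Equivalence.to P⇔b p)
does≡ (no ¬p) {false} P⇔b = refl
does≡ (no ¬p) {true}  P⇔b = ⊥-elim (¬p (Equivalence.from P⇔b refl))

module _ {A : Set} where

  ∑ : List A → (A → ℕ) → ℕ
  ∑ []       f = 0
  ∑ (a ∷ as) f = f a + ∑ as f

  syntax ∑ L (λ a → e) = ∑[ a ∈ L ] e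

  ∑-cong : ∀ L {f g : A → ℕ} → (∀ a → f a ≡ g a) → ∑ L f ≡ ∑ L g
  ∑-cong []      e = refl
  ∑-cong (a ∷ L) e = cong₂ _+_ (e a) (∑-cong L e)

  ∑-zero : ∀ L → ∑[ a ∈ L ] 0 ≡ 0
  ∑-zero []      = refl
  ∑-zero (a ∷ L) = ∑-zero L

  ∑-+ : ∀ L (f g : A → ℕ) → ∑[ a ∈ L ] (f a + g a) ≡ ∑ L f + ∑ L g
  ∑-+ []      f g = refl
  ∑-+ (a ∷ L) f g = trans (cong (f a + g a +_) (∑-+ L f g)) (+-interchange (f a) (g a) (∑ L f) (∑ L g))

  ∑-*ˡ : ∀ L c (f : A → ℕ) → ∑[ a ∈ L ] (c * f a) ≡ c * ∑ L f
  ∑-*ˡ []      c f = sym (*-zeroʳ c)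
  ∑-*ˡ (a ∷ L) c f = trans (cong (c * f a +_) (∑-*ˡ L c f)) (sym (*-distribˡ-+ c (f a) (∑ L f)))

  ∑-*ʳ : ∀ L c (f : A → ℕ) → ∑[ a ∈ L ] (f a * c) ≡ ∑ L f * c
  ∑-*ʳ L c f = trans (∑-cong L (λ a → *-comm (f a) c)) (trans (∑-*ˡ L c f) (*-comm c (∑ L f)))

  ∑-++ : ∀ L M (f : A → ℕ) → ∑ (L ++ M) f ≡ ∑ L f + ∑ M f
  ∑-++ []      M f = refl
  ∑-++ (a ∷ L) M f = trans (cong (f a +_) (∑-++ L M f)) (sym (+-assoc (f a) _ _))

∑-map : ∀ {A B : Set} (g : A → B) L (f : B → ℕ) → ∑ (map g L) f ≡ ∑ L (f ∘ g)
∑-map g []      f = refl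
∑-map g (a ∷ L) f = cong (f (g a) +_) (∑-map g L f)

∑-concatMap : ∀ {A B : Set} (g : A → List B) L (f : B → ℕ) →
  ∑ (concatMap g L) f ≡ ∑[ a ∈ L ] ∑ (g a) f
∑-concatMap g []      f = refl
∑-concatMap g (a ∷ L) f = trans (∑-++ (g a) (concatMap g L) f) (cong (∑ (g a) f +_) (∑-concatMap g L f))

length-filter : ∀ {A : Set} {P : A → Set} (P? : ∀ a → Dec (P a)) (L : List A) →
  length (filter P? L) ≡ ∑[ a ∈ L ] 𝟙 (does (P? a))
length-filter P? []      = refl
length-filter P? (a ∷ L) with does (P? a)
... | true  = cong suc (length-filter P? L)
... | false = length-filter P? L

∑-comm : ∀ {A B : Set} (L : List A) (M : List B) (f : A → B → ℕ) →
  ∑[ a ∈ L ] ∑[ b ∈ M ] f a b ≡ ∑[ b ∈ M ] ∑[ a ∈ L ] f a b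
∑-comm []      M f = sym (∑-zero M)
∑-comm (a ∷ L) M f = trans (cong (∑ M (f a) +_) (∑-comm L M f)) (sym (∑-+ M (f a) (λ b → ∑[ a′ ∈ L ] f a′ b)))

∑-cartesianProduct : ∀ {A B : Set} (L : List A) (M : List B) (f : A × B → ℕ) →
  ∑ (cartesianProduct L M) f ≡ ∑[ a ∈ L ] ∑[ b ∈ M ] f (a , b)
∑-cartesianProduct []      M f = refl
∑-cartesianProduct (a ∷ L) M f =
  trans (∑-++ (map (a ,_) M) (cartesianProduct L M) f) (cong₂ _+_ (∑-map (a ,_) M f) (∑-cartesianProduct L M f))

∑-allFin-suc : ∀ n (f : Fin (suc n) → ℕ) → ∑ (allFin (suc n)) f ≡ f zero + ∑[ i ∈ allFin n ] f (suc i)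
∑-allFin-suc n f = cong (f zero +_) (trans (cong (λ L → ∑ L f) (sym (map-tabulate id suc))) (∑-map suc (allFin n) f))

∑-allFin-≟ : ∀ n (j : Fin n) → ∑[ i ∈ allFin n ] 𝟙 (does (i ≟ j)) ≡ 1
∑-allFin-≟ (suc n) j = trans (∑-allFin-suc n (λ i → 𝟙 (does (i ≟ j)))) (rest j)
  where
  rest : ∀ j → 𝟙 (does (zero ≟ j)) + ∑[ i ∈ allFin n ] 𝟙 (does (suc i ≟ j)) ≡ 1
  rest zero    = cong suc (∑-zero (allFin n))
  rest (suc j) = ∑-allFin-≟ n j

∑-allFin-lookup : ∀ {n} (A : Subset n) → ∑[ i ∈ allFin n ] 𝟙 (lookup A i) ≡ ∣ A ∣
∑-allFin-lookup []ᵥ = refl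
∑-allFin-lookup {suc n} (a ∷ᵥ A) = trans (∑-allFin-suc n (𝟙 ∘ lookup (a ∷ᵥ A))) (step a)
  where
  step : ∀ a → 𝟙 a + ∑[ i ∈ allFin n ] 𝟙 (lookup A i) ≡ ∣ a ∷ᵥ A ∣
  step true  = cong suc (∑-allFin-lookup A)
  step false = ∑-allFin-lookup A

∑₁ : ℕ → (ℕ → ℕ) → ℕ
∑₁ zero    f = 0
∑₁ (suc N) f = ∑₁ N f + f (suc N)

∑₁-cong : ∀ N {f g : ℕ → ℕ} → (∀ i → f i ≡ g i) → ∑₁ N f ≡ ∑₁ N g
∑₁-cong zero    e = refl
∑₁-cong (suc N) e = cong₂ _+_ (∑₁-cong N e) (e (suc N))

∑₁-zero : ∀ N (f : ℕ → ℕ) → (∀ i → f (suc i) ≡ 0) → ∑₁ N f ≡ 0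
∑₁-zero zero    f z = refl
∑₁-zero (suc N) f z = cong₂ _+_ (∑₁-zero N f z) (z N)

∑₁-+ : ∀ N (f g : ℕ → ℕ) → ∑₁ N (λ i → f i + g i) ≡ ∑₁ N f + ∑₁ N g
∑₁-+ zero    f g = refl
∑₁-+ (suc N) f g = trans (cong (_+ (f (suc N) + g (suc N))) (∑₁-+ N f g)) (+-interchange (∑₁ N f) (∑₁ N g) _ _)

∑₁-*ˡ : ∀ N c (f : ℕ → ℕ) → ∑₁ N (λ i → c * f i) ≡ c * ∑₁ N f
∑₁-*ˡ zero    c f = sym (*-zeroʳ c)
∑₁-*ˡ (suc N) c f = trans (cong (_+ c * f (suc N)) (∑₁-*ˡ N c f)) (sym (*-distribˡ-+ c (∑₁ N f) (f (suc N))))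

∑₁-shift : ∀ N (f : ℕ → ℕ) → ∑₁ (suc N) f ≡ f 1 + ∑₁ N (f ∘ suc)
∑₁-shift zero    f = +-comm 0 (f 1)
∑₁-shift (suc N) f = trans (cong (_+ f (suc (suc N))) (∑₁-shift N f)) (+-assoc (f 1) _ _)

P≡P′ : ∀ {x i} → i ≤ x → x P i ≡ x P′ i
P≡P′ {x} {i} i≤x with i ℕ.≤ᵇ x | ≤⇒≤ᵇ i≤x
... | true | _ = refl

fall≡P′ : ∀ x i → fall x i ≡ x P′ i
fall≡P′ x zero    = refl
fall≡P′ x (suc i) = trans (cong (_* (x ∸ i)) (fall≡P′ x i)) (*-comm (x P′ i) (x ∸ i))

fall≡!*C : ∀ x i → fall x i ≡ i ! * (x C i)
fall≡!*C x i with i ℕ.≤? x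
... | yes i≤x = begin
  fall x i               ≡⟨ fall≡P′ x i ⟩
  x P′ i                 ≡⟨ m*[n/m]≡n (k!∣nP′k i≤x) ⟨
  i ! * ((x P′ i) / i !) ≡⟨ cong (λ p → i ! * (p / i !)) (P≡P′ i≤x) ⟨
  i ! * ((x P i) / i !)  ≡⟨ cong (i ! *_) (nCk≡nPk/k! i≤x) ⟨
  i ! * (x C i)          ∎
  where
  open ≡-Reasoning
  instance _ = i !≢0
... | no i≰x = begin
  fall x i      ≡⟨ fall-vanishes i (≰⇒> i≰x) ⟩
  0             ≡⟨ *-zeroʳ (i !) ⟨
  i ! * 0       ≡⟨ cong (i ! *_) (k>n⇒nCk≡0 (≰⇒> i≰x)) ⟨
  i ! * (x C i) ∎
  where
  open ≡-Reasoning
  fall-vanishes : ∀ i → x < i → fall x i ≡ 0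
  fall-vanishes (suc i) (s≤s x≤i) = trans (cong (fall x i *_) (m≤n⇒m∸n≡0 x≤i)) (*-zeroʳ (fall x i))

subsets : ∀ n → List (Subset n)
subsets zero    = []ᵥ ∷ []
subsets (suc n) = map (true ∷ᵥ_) (subsets n) ++ map (false ∷ᵥ_) (subsets n)

∑-subsets-suc : ∀ n (f : Subset (suc n) → ℕ) →
  ∑ (subsets (suc n)) f ≡ ∑[ S ∈ subsets n ] f (true ∷ᵥ S) + ∑[ S ∈ subsets n ] f (false ∷ᵥ S)
∑-subsets-suc n f = trans (∑-++ (map (true ∷ᵥ_) (subsets n)) _ f)
  (cong₂ _+_ (∑-map (true ∷ᵥ_) (subsets n) f) (∑-map (false ∷ᵥ_) (subsets n) f))

∑-subsets-card : ∀ {n N} → n ≤ N → (g : ℕ → ℕ) → ∑[ S ∈ subsets n ] g ∣ S ∣ ≡ g 0 + ∑₁ N (λ l → (n C l) * g l)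
∑-subsets-card {zero} {N} _ g = cong (g 0 +_) (sym (∑₁-zero N _ (λ _ → refl)))
∑-subsets-card {suc n} {suc N} (s≤s n≤N) g = begin
  ∑ (subsets (suc n)) (g ∘ ∣_∣)
    ≡⟨ ∑-subsets-suc n (g ∘ ∣_∣) ⟩
  ∑[ S ∈ subsets n ] g (suc ∣ S ∣) + ∑[ S ∈ subsets n ] g ∣ S ∣
    ≡⟨ cong₂ _+_ (∑-subsets-card n≤1+N (g ∘ suc)) (∑-subsets-card n≤1+N g) ⟩
  (g 1 + (∑₁ N (λ l → (n C l) * g (suc l)) + (n C suc N) * g (2 + N))) + (g 0 + ∑₁ (suc N) (λ l → (n C l) * g l))
    ≡⟨ cong₂ (λ z w → (g 1 + (∑₁ N (λ l → (n C l) * g (suc l)) + z * g (2 + N))) + (g 0 + w))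
         (k>n⇒nCk≡0 (s≤s n≤N)) (∑₁-shift N (λ l → (n C l) * g l)) ⟩
  (g 1 + (X + 0 * g (2 + N))) + (g 0 + ((n C 1) * g 1 + Y))
    ≡⟨ rearrange (g 0) (g 1) (n C 1) X Y (g (2 + N)) ⟩
  g 0 + ((1 + (n C 1)) * g 1 + (X + Y))
    ≡⟨ cong (λ z → g 0 + ((1 + (n C 1)) * g 1 + z)) (∑₁-+ N _ _) ⟨
  g 0 + ((1 + (n C 1)) * g 1 + ∑₁ N (λ l → (n C l) * g (suc l) + (n C suc l) * g (suc l)))
    ≡⟨ cong₂ (λ z w → g 0 + (z * g 1 + w)) (nCk+nC[k+1]≡[n+1]C[k+1] n 0)
         (∑₁-cong N (λ l → trans (sym (*-distribʳ-+ (g (suc l)) (n C l) (n C suc l)))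
                                 (cong (_* g (suc l)) (nCk+nC[k+1]≡[n+1]C[k+1] n l)))) ⟩
  g 0 + ((suc n C 1) * g 1 + ∑₁ N (λ l → (suc n C suc l) * g (suc l)))
    ≡⟨ cong (g 0 +_) (∑₁-shift N (λ l → (suc n C l) * g l)) ⟨
  g 0 + ∑₁ (suc N) (λ l → (suc n C l) * g l)
    ∎
  where
  open ≡-Reasoning
  n≤1+N = m≤n⇒m≤1+n n≤N
  X = ∑₁ N (λ l → (n C l) * g (suc l))
  Y = ∑₁ N (λ l → (n C suc l) * g (suc l))
  rearrange : ∀ g₀ g₁ c x y z → (g₁ + (x + 0 * z)) + (g₀ + (c * g₁ + y)) ≡ g₀ + ((1 + c) * g₁ + (x + y))
  rearrange = solve-∀

_≟ˢ_ : ∀ {n} (A B : Subset n) → Dec (A ≡ B)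
_≟ˢ_ = Vecₚ.≡-dec Boolₚ._≟_

insert : ∀ {n} → Fin n → Subset n → Subset n
insert zero    (_ ∷ᵥ A) = true ∷ᵥ A
insert (suc i) (a ∷ᵥ A) = a ∷ᵥ insert i A

remove : ∀ {n} → Fin n → Subset n → Subset n
remove zero    (_ ∷ᵥ A) = false ∷ᵥ A
remove (suc i) (a ∷ᵥ A) = a ∷ᵥ remove i A

lookup-insert : ∀ {n} (i : Fin n) A → lookup (insert i A) i ≡ true
lookup-insert zero    (a ∷ᵥ A) = refl
lookup-insert (suc i) (a ∷ᵥ A) = lookup-insert i A

lookup-insert-mono : ∀ {n} (i j : Fin n) A → lookup A j ≡ true → lookup (insert i A) j ≡ true
lookup-insert-mono zero    zero    (a ∷ᵥ A) _ = refl
lookup-insert-mono zero    (suc j) (a ∷ᵥ A) e = e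
lookup-insert-mono (suc i) zero    (a ∷ᵥ A) e = e
lookup-insert-mono (suc i) (suc j) (a ∷ᵥ A) e = lookup-insert-mono i j A e

lookup-insert⁻ : ∀ {n} (i j : Fin n) A → lookup (insert i A) j ≡ true → i ≡ j ⊎ lookup A j ≡ true
lookup-insert⁻ zero    zero    (a ∷ᵥ A) _ = inj₁ refl
lookup-insert⁻ zero    (suc j) (a ∷ᵥ A) e = inj₂ e
lookup-insert⁻ (suc i) zero    (a ∷ᵥ A) e = inj₂ e
lookup-insert⁻ (suc i) (suc j) (a ∷ᵥ A) e with lookup-insert⁻ i j A e
... | inj₁ i≡j = inj₁ (cong suc i≡j)
... | inj₂ j∈A = inj₂ j∈A

lookup-remove : ∀ {n} (i : Fin n) A → lookup (remove i A) i ≡ false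
lookup-remove zero    (a ∷ᵥ A) = refl
lookup-remove (suc i) (a ∷ᵥ A) = lookup-remove i A

suc-∣remove∣ : ∀ {n} (i : Fin n) A → lookup A i ≡ true → suc ∣ remove i A ∣ ≡ ∣ A ∣
suc-∣remove∣ zero    (true ∷ᵥ A)  _ = refl
suc-∣remove∣ (suc i) (true ∷ᵥ A)  e = cong suc (suc-∣remove∣ i A e)
suc-∣remove∣ (suc i) (false ∷ᵥ A) e = suc-∣remove∣ i A e

-- The two alternatives are exclusive: [A ≡ R] forces i ∈ A, while [A ≡ R - i] forces i ∉ A.
insert≟ˢ : ∀ {n} (i : Fin n) A R →
  𝟙 (does (insert i A ≟ˢ R)) ≡ 𝟙 (lookup R i) * (𝟙 (does (A ≟ˢ R)) + 𝟙 (does (A ≟ˢ remove i R)))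
insert≟ˢ zero (a ∷ᵥ A) (b ∷ᵥ B) with does (A ≟ˢ B)
insert≟ˢ zero (true  ∷ᵥ A) (true  ∷ᵥ B) | true  = refl
insert≟ˢ zero (false ∷ᵥ A) (true  ∷ᵥ B) | true  = refl
insert≟ˢ zero (_     ∷ᵥ A) (false ∷ᵥ B) | true  = refl
insert≟ˢ zero (true  ∷ᵥ A) (true  ∷ᵥ B) | false = refl
insert≟ˢ zero (false ∷ᵥ A) (true  ∷ᵥ B) | false = refl
insert≟ˢ zero (_     ∷ᵥ A) (false ∷ᵥ B) | false = refl
insert≟ˢ (suc i) (a ∷ᵥ A) (b ∷ᵥ B) with does (a Boolₚ.≟ b)
... | true  = insert≟ˢ i A B
... | false = sym (*-zeroʳ (𝟙 (lookup B i)))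

⊥≟ˢ : ∀ {n} (A : Subset n) → does (⊥ ≟ˢ A) ≡ (∣ A ∣ ≡ᵇ 0)
⊥≟ˢ []ᵥ         = refl
⊥≟ˢ (true ∷ᵥ A)  = refl
⊥≟ˢ (false ∷ᵥ A) = ⊥≟ˢ A

∑-subsets-≟ˢ : ∀ {n} (A : Subset n) → ∑[ R ∈ subsets n ] 𝟙 (does (A ≟ˢ R)) ≡ 1
∑-subsets-≟ˢ []ᵥ = refl
∑-subsets-≟ˢ {suc n} (a ∷ᵥ A) = trans (∑-subsets-suc n (λ R → 𝟙 (does ((a ∷ᵥ A) ≟ˢ R)))) (split a)
  where
  split : ∀ a → ∑[ R ∈ subsets n ] 𝟙 (does (a Boolₚ.≟ true) ∧ does (A ≟ˢ R))
              + ∑[ R ∈ subsets n ] 𝟙 (does (a Boolₚ.≟ false) ∧ does (A ≟ˢ R)) ≡ 1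
  split true  = cong₂ _+_ (∑-subsets-≟ˢ A) (∑-zero (subsets n))
  split false = cong₂ _+_ (∑-zero (subsets n)) (∑-subsets-≟ˢ A)

lookup≡true⇒≡⊤ : ∀ {n} {A : Subset n} → (∀ i → lookup A i ≡ true) → A ≡ ⊤
lookup≡true⇒≡⊤ {A = []ᵥ}     _   = refl
lookup≡true⇒≡⊤ {A = a ∷ᵥ A} all = cong₂ _∷ᵥ_ (all zero) (lookup≡true⇒≡⊤ (all ∘ suc))

image : ∀ {A : Set} {n k} → (A → Fin n) → Vec A k → Subset n
image f []ᵥ      = ⊥
image f (a ∷ᵥ t) = insert (f a) (image f t)

module _ {A : Set} {n} (f : A → Fin n) where

  lookup-image : ∀ {k} (t : Vec A k) j → lookup (image f t) (f (lookup t j)) ≡ true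
  lookup-image (a ∷ᵥ t) zero    = lookup-insert (f a) (image f t)
  lookup-image (a ∷ᵥ t) (suc j) = lookup-insert-mono (f a) _ (image f t) (lookup-image t j)

  lookup-image⁻ : ∀ {k} (t : Vec A k) i → lookup (image f t) i ≡ true → ∃ λ j → f (lookup t j) ≡ i
  lookup-image⁻ []ᵥ      i e with () ← trans (sym (Vecₚ.lookup-replicate i false)) e
  lookup-image⁻ (a ∷ᵥ t) i e with lookup-insert⁻ (f a) i (image f t) e
  ... | inj₁ fa≡i = zero , fa≡i
  ... | inj₂ e′   with lookup-image⁻ t i e′
  ...   | j , p = suc j , p

  image≡⊤⇔surjective : ∀ {k} (t : Vec A k) → image f t ≡ ⊤ ⇔ (∀ i → ∃ λ j → f (lookup t j) ≡ i)
  image≡⊤⇔surjective t = mk⇔ to from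
    where
    to : image f t ≡ ⊤ → ∀ i → ∃ λ j → f (lookup t j) ≡ i
    to e i = lookup-image⁻ t i (trans (cong (λ B → lookup B i) e) (Vecₚ.lookup-replicate i true))
    from : (∀ i → ∃ λ j → f (lookup t j) ≡ i) → image f t ≡ ⊤
    from surj = lookup≡true⇒≡⊤ (λ i → let (j , p) = surj i in subst (λ r → lookup (image f t) r ≡ true) p (lookup-image t j))

allVecs-suc : ∀ {A : Set} (xs : List A) k (f : Vec A (suc k) → ℕ) →
  ∑ (allVecs xs (suc k)) f ≡ ∑[ a ∈ xs ] ∑[ t ∈ allVecs xs k ] f (a ∷ᵥ t)
allVecs-suc xs k f = trans (∑-concatMap (λ a → map (a ∷ᵥ_) (allVecs xs k)) xs f)
                           (∑-cong xs (λ a → ∑-map (a ∷ᵥ_) (allVecs xs k) f))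

-- Deleting one number from a (k+1)-conjoint l × m table either leaves a k-conjoint l × m table, in which it
-- occupied one of the l m - k empty cells, or empties its column, its row, or both, which are then deleted; in
-- those cases its cell is any of the l m cells.
tableCount : ℕ → ℕ → ℕ → ℕ
tableCount zero    l m = 𝟙 ((l ≡ᵇ 0) ∧ (m ≡ᵇ 0))
tableCount (suc k) l m = (l * m ∸ k) * tableCount k l m
  + l * m * (tableCount k l (m ∸ 1) + tableCount k (l ∸ 1) m + tableCount k (l ∸ 1) (m ∸ 1))

module Grid (x y : ℕ) where

  cells : List (Cell x y)
  cells = cartesianProduct (allFin x) (allFin y)

  ∑-cells-* : (g : Fin x → ℕ) (g′ : Fin y → ℕ) →
    ∑[ h ∈ cells ] (g (proj₁ h) * g′ (proj₂ h)) ≡ ∑ (allFin x) g * ∑ (allFin y) g′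
  ∑-cells-* g g′ = trans (∑-cartesianProduct (allFin x) (allFin y) (λ h → g (proj₁ h) * g′ (proj₂ h)))
    (trans (∑-cong (allFin x) (λ r → ∑-*ˡ (allFin y) (g r) g′)) (∑-*ʳ (allFin x) _ g))

  inRect : Subset x → Subset y → Cell x y → Bool
  inRect R S (r , c) = lookup R r ∧ lookup S c

  ∑-inRect : ∀ R S → ∑[ h ∈ cells ] 𝟙 (inRect R S h) ≡ ∣ R ∣ * ∣ S ∣
  ∑-inRect R S = trans (∑-cong cells (λ h → 𝟙-∧ (lookup R (proj₁ h)) _))
    (trans (∑-cells-* (𝟙 ∘ lookup R) (𝟙 ∘ lookup S)) (cong₂ _*_ (∑-allFin-lookup R) (∑-allFin-lookup S)))

  ∑-cells-1 : ∑[ h ∈ cells ] 1 ≡ x * y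
  ∑-cells-1 = trans (∑-cells-* (λ _ → 1) (λ _ → 1)) (cong₂ _*_ (count x) (count y))
    where
    count : ∀ n → ∑[ i ∈ allFin n ] 1 ≡ n
    count zero    = refl
    count (suc n) = trans (∑-allFin-suc n (λ _ → 1)) (cong suc (count n))

  _==_ : Cell x y → Cell x y → Bool
  (r , c) == (r′ , c′) = does (r ≟ r′) ∧ does (c ≟ c′)

  ==-refl : ∀ h → h == h ≡ true
  ==-refl (r , c) = cong₂ _∧_ (dec-true (r ≟ r) refl) (dec-true (c ≟ c) refl)

  ==-sound : ∀ h h′ → h == h′ ≡ true → h ≡ h′
  ==-sound (r , c) (r′ , c′) e with ∧-true {does (r ≟ r′)} e
  ... | e₁ , e₂ = cong₂ _,_ (does≡true⇒ (r ≟ r′) e₁) (does≡true⇒ (c ≟ c′) e₂)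

  ∑-== : ∀ h₀ → ∑[ h ∈ cells ] 𝟙 (h == h₀) ≡ 1
  ∑-== (r₀ , c₀) = trans (∑-cong cells (λ h → 𝟙-∧ (does (proj₁ h ≟ r₀)) _))
    (trans (∑-cells-* (λ r → 𝟙 (does (r ≟ r₀))) (λ c → 𝟙 (does (c ≟ c₀))))
           (cong₂ _*_ (∑-allFin-≟ x r₀) (∑-allFin-≟ y c₀)))

  occurs : ∀ {k} → Cell x y → Vec (Cell x y) k → Bool
  occurs h []ᵥ       = false
  occurs h (h′ ∷ᵥ t) = h == h′ ∨ occurs h t

  distinct : ∀ {k} → Vec (Cell x y) k → Bool
  distinct []ᵥ      = true
  distinct (h ∷ᵥ t) = not (occurs h t) ∧ distinct t

  occurs-lookup : ∀ {k} (t : Vec (Cell x y) k) j → occurs (lookup t j) t ≡ true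
  occurs-lookup (h ∷ᵥ t) zero    = cong (_∨ occurs h t) (==-refl h)
  occurs-lookup (h ∷ᵥ t) (suc j) = trans (cong (lookup t j == h ∨_) (occurs-lookup t j)) (Boolₚ.∨-zeroʳ _)

  occurs⁻ : ∀ {k} h (t : Vec (Cell x y) k) → occurs h t ≡ true → ∃ λ j → lookup t j ≡ h
  occurs⁻ h (h′ ∷ᵥ t) e with h == h′ in e′
  ... | true  = zero , sym (==-sound h h′ e′)
  ... | false with occurs⁻ h t e
  ...   | j , p = suc j , p

  occurs⇒lookup-image : ∀ {n k} (f : Cell x y → Fin n) h (t : Vec (Cell x y) k) →
    occurs h t ≡ true → lookup (image f t) (f h) ≡ true
  occurs⇒lookup-image f h t e with occurs⁻ h t e
  ... | j , refl = lookup-image f t j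

  distinct⇔injective : ∀ {k} (t : Vec (Cell x y) k) →
    distinct t ≡ true ⇔ (∀ i j → lookup t i ≡ lookup t j → i ≡ j)
  distinct⇔injective t = mk⇔ (to t) (from t)
    where
    to : ∀ {k} (t : Vec (Cell x y) k) → distinct t ≡ true → ∀ i j → lookup t i ≡ lookup t j → i ≡ j
    to (h ∷ᵥ t) e zero    zero    _ = refl
    to (h ∷ᵥ t) e zero    (suc j) p with ∧-true {not (occurs h t)} e
    ... | e₁ , _ rewrite p | occurs-lookup t j with () ← e₁
    to (h ∷ᵥ t) e (suc i) zero    p with ∧-true {not (occurs h t)} e
    ... | e₁ , _ rewrite sym p | occurs-lookup t i with () ← e₁
    to (h ∷ᵥ t) e (suc i) (suc j) p = cong suc (to t (proj₂ (∧-true {not (occurs h t)} e)) i j p)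
    from : ∀ {k} (t : Vec (Cell x y) k) → (∀ i j → lookup t i ≡ lookup t j → i ≡ j) → distinct t ≡ true
    from []ᵥ      _   = refl
    from (h ∷ᵥ t) inj = cong₂ _∧_ fresh (from t (λ i j p → Finₚ.suc-injective (inj (suc i) (suc j) p)))
      where
      fresh : not (occurs h t) ≡ true
      fresh with occurs h t in e
      ... | false = refl
      ... | true with occurs⁻ h t e
      ...   | j , p with () ← inj zero (suc j) (sym p)

  ∑-occurs : ∀ {k} (t : Vec (Cell x y) k) → distinct t ≡ true → ∑[ h ∈ cells ] 𝟙 (occurs h t) ≡ k
  ∑-occurs []ᵥ      _ = ∑-zero cells
  ∑-occurs (h₀ ∷ᵥ t) e with ∧-true {not (occurs h₀ t)} e
  ... | fresh , distinct-t = trans (∑-cong cells split)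
    (trans (∑-+ cells (λ h → 𝟙 (h == h₀)) (λ h → 𝟙 (occurs h t))) (cong₂ _+_ (∑-== h₀) (∑-occurs t distinct-t)))
    where
    split : ∀ h → 𝟙 (h == h₀ ∨ occurs h t) ≡ 𝟙 (h == h₀) + 𝟙 (occurs h t)
    split h with h == h₀ in e′
    ... | false = refl
    ... | true rewrite ==-sound h h₀ e′ | Boolₚ.not-injective fresh = refl

  ∑-fresh : ∀ {k} (q : Cell x y → Bool) (t : Vec (Cell x y) k) → distinct t ≡ true →
    (∀ h → occurs h t ≡ true → q h ≡ true) →
    ∑[ h ∈ cells ] (𝟙 (q h) * 𝟙 (not (occurs h t))) ≡ ∑[ h ∈ cells ] 𝟙 (q h) ∸ k
  ∑-fresh {k} q t distinct-t q⊇t = sym (trans (cong (_∸ k) (sym total)) (m+n∸n≡m _ k))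
    where
    split : ∀ h → 𝟙 (q h) * 𝟙 (not (occurs h t)) + 𝟙 (occurs h t) ≡ 𝟙 (q h)
    split h with occurs h t in e
    ... | true  rewrite q⊇t h e = refl
    ... | false = trans (+-identityʳ _) (*-identityʳ _)
    total : ∑[ h ∈ cells ] (𝟙 (q h) * 𝟙 (not (occurs h t))) + k ≡ ∑[ h ∈ cells ] 𝟙 (q h)
    total = trans (cong (∑[ h ∈ cells ] (𝟙 (q h) * 𝟙 (not (occurs h t))) +_) (sym (∑-occurs t distinct-t)))
      (trans (sym (∑-+ cells _ _)) (∑-cong cells split))

  ∑-distinct : ∀ k → ∑[ t ∈ allVecs cells k ] 𝟙 (distinct t) ≡ fall (x * y) k
  ∑-distinct zero    = refl
  ∑-distinct (suc k) = begin
    ∑ (allVecs cells (suc k)) (𝟙 ∘ distinct)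
      ≡⟨ allVecs-suc cells k (𝟙 ∘ distinct) ⟩
    ∑[ h ∈ cells ] ∑[ t ∈ Ts ] 𝟙 (not (occurs h t) ∧ distinct t)
      ≡⟨ ∑-cong cells (λ h → ∑-cong Ts (λ t → trans (𝟙-∧ (not (occurs h t)) _) (*-comm _ (𝟙 (distinct t))))) ⟩
    ∑[ h ∈ cells ] ∑[ t ∈ Ts ] (𝟙 (distinct t) * 𝟙 (not (occurs h t)))
      ≡⟨ ∑-comm cells Ts _ ⟩
    ∑[ t ∈ Ts ] ∑[ h ∈ cells ] (𝟙 (distinct t) * 𝟙 (not (occurs h t)))
      ≡⟨ ∑-cong Ts (λ t → trans (∑-*ˡ cells (𝟙 (distinct t)) _) (free t)) ⟩
    ∑[ t ∈ Ts ] (𝟙 (distinct t) * (x * y ∸ k))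
      ≡⟨ ∑-*ʳ Ts (x * y ∸ k) (𝟙 ∘ distinct) ⟩
    ∑[ t ∈ Ts ] 𝟙 (distinct t) * (x * y ∸ k)
      ≡⟨ cong (_* (x * y ∸ k)) (∑-distinct k) ⟩
    fall (x * y) (suc k) ∎
    where
    open ≡-Reasoning
    Ts = allVecs cells k
    free : ∀ t → 𝟙 (distinct t) * ∑[ h ∈ cells ] 𝟙 (not (occurs h t)) ≡ 𝟙 (distinct t) * (x * y ∸ k)
    free t with distinct t in e
    ... | false = refl
    ... | true  = cong (1 *_) (trans (∑-cong cells (λ h → sym (*-identityˡ _)))
                    (trans (∑-fresh (λ _ → true) t e (λ _ _ → refl)) (cong (_∸ k) ∑-cells-1)))

  occupies : ∀ {k} → Subset x → Subset y → Vec (Cell x y) k → Bool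
  occupies R S t = distinct t ∧ (does (image proj₁ t ≟ˢ R) ∧ does (image proj₂ t ≟ˢ S))

  placements : ℕ → Subset x → Subset y → ℕ
  placements k R S = ∑[ t ∈ allVecs cells k ] 𝟙 (occupies R S t)

  𝟙-occupies : ∀ {k} R S (t : Vec (Cell x y) k) →
    𝟙 (occupies R S t) ≡ 𝟙 (distinct t) * (𝟙 (does (image proj₁ t ≟ˢ R)) * 𝟙 (does (image proj₂ t ≟ˢ S)))
  𝟙-occupies R S t = trans (𝟙-∧ (distinct t) _) (cong (𝟙 (distinct t) *_) (𝟙-∧ (does (image proj₁ t ≟ˢ R)) _))

  fresh-if-image-removed : ∀ {n k} (f : Cell x y → Fin n) h (t : Vec (Cell x y) k) A →
    𝟙 (not (occurs h t)) * 𝟙 (does (image f t ≟ˢ remove (f h) A)) ≡ 𝟙 (does (image f t ≟ˢ remove (f h) A))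
  fresh-if-image-removed f h t A with does (image f t ≟ˢ remove (f h) A) in e
  ... | false = *-zeroʳ (𝟙 (not (occurs h t)))
  ... | true with occurs h t in o
  ...   | false = refl
  ...   | true with () ← trans (sym (occurs⇒lookup-image f h t o))
                               (trans (cong (λ B → lookup B (f h)) (does≡true⇒ (image f t ≟ˢ _) e)) (lookup-remove (f h) A))

  -- t must avoid h only in the first case: in the others it misses the row or the column of h.
  occupies-∷ : ∀ {k} R S h (t : Vec (Cell x y) k) →
    let R′ = remove (proj₁ h) R; S′ = remove (proj₂ h) S in
    𝟙 (occupies R S (h ∷ᵥ t)) ≡ 𝟙 (inRect R S h) *
      (𝟙 (not (occurs h t)) * 𝟙 (occupies R S t) + (𝟙 (occupies R S′ t) + 𝟙 (occupies R′ S t) + 𝟙 (occupies R′ S′ t)))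
  occupies-∷ R S h t = begin
    𝟙 (distinct (h ∷ᵥ t) ∧ (rowsR ∧ colsS))
      ≡⟨ 𝟙-∧ (distinct (h ∷ᵥ t)) (rowsR ∧ colsS) ⟩
    𝟙 (distinct (h ∷ᵥ t)) * 𝟙 (rowsR ∧ colsS)
      ≡⟨ cong₂ _*_ (𝟙-∧ (not (occurs h t)) (distinct t)) (𝟙-∧ rowsR colsS) ⟩
    n * i * (𝟙 rowsR * 𝟙 colsS)
      ≡⟨ cong (λ z → n * i * z) (cong₂ _*_ (insert≟ˢ (proj₁ h) (image proj₁ t) R) (insert≟ˢ (proj₂ h) (image proj₂ t) S)) ⟩
    n * i * (ρ * (a + b) * (γ * (c + d)))
      ≡⟨ expand n i ρ γ a b c d (fresh-if-image-removed proj₁ h t R) (fresh-if-image-removed proj₂ h t S) ⟩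
    ρ * γ * (n * (i * (a * c)) + (i * (a * d) + i * (b * c) + i * (b * d)))
      ≡⟨ cong (_* (n * (i * (a * c)) + (i * (a * d) + i * (b * c) + i * (b * d)))) (𝟙-∧ (lookup R (proj₁ h)) _) ⟨
    𝟙 (inRect R S h) * (n * (i * (a * c)) + (i * (a * d) + i * (b * c) + i * (b * d)))
      ≡⟨ cong (𝟙 (inRect R S h) *_) (cong₂ _+_ (cong (n *_) (𝟙-occupies R S t))
           (cong₂ _+_ (cong₂ _+_ (𝟙-occupies R S′ t) (𝟙-occupies R′ S t)) (𝟙-occupies R′ S′ t))) ⟨
    𝟙 (inRect R S h) * (n * 𝟙 (occupies R S t) + (𝟙 (occupies R S′ t) + 𝟙 (occupies R′ S t) + 𝟙 (occupies R′ S′ t))) ∎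
    where
    expand : ∀ n i ρ γ a b c d → n * b ≡ b → n * d ≡ d →
      n * i * (ρ * (a + b) * (γ * (c + d))) ≡ ρ * γ * (n * (i * (a * c)) + (i * (a * d) + i * (b * c) + i * (b * d)))
    expand n i ρ γ a b c d nb≡b nd≡d = trans (ring n i ρ γ a b c d)
      (cong₂ (λ u v → ρ * γ * (n * (i * (a * c)) + (i * (a * v) + i * (u * c) + i * (u * d)))) nb≡b nd≡d)
      where
      ring : ∀ n i ρ γ a b c d → n * i * (ρ * (a + b) * (γ * (c + d)))
           ≡ ρ * γ * (n * (i * (a * c)) + (i * (a * (n * d)) + i * ((n * b) * c) + i * ((n * b) * d)))
      ring = solve-∀
    open ≡-Reasoning
    R′ = remove (proj₁ h) R
    S′ = remove (proj₂ h) S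
    rowsR = does (image proj₁ (h ∷ᵥ t) ≟ˢ R)
    colsS = does (image proj₂ (h ∷ᵥ t) ≟ˢ S)
    n = 𝟙 (not (occurs h t))
    i = 𝟙 (distinct t)
    ρ = 𝟙 (lookup R (proj₁ h))
    γ = 𝟙 (lookup S (proj₂ h))
    a = 𝟙 (does (image proj₁ t ≟ˢ R))
    b = 𝟙 (does (image proj₁ t ≟ˢ remove (proj₁ h) R))
    c = 𝟙 (does (image proj₂ t ≟ˢ S))
    d = 𝟙 (does (image proj₂ t ≟ˢ remove (proj₂ h) S))

  ∑-fresh-occupies : ∀ k R S →
    ∑[ h ∈ cells ] (𝟙 (inRect R S h) * ∑[ t ∈ allVecs cells k ] (𝟙 (not (occurs h t)) * 𝟙 (occupies R S t)))
      ≡ (∣ R ∣ * ∣ S ∣ ∸ k) * placements k R S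
  ∑-fresh-occupies k R S = begin
    ∑[ h ∈ cells ] (𝟙 (inRect R S h) * ∑[ t ∈ Ts ] (𝟙 (not (occurs h t)) * 𝟙 (occupies R S t)))
      ≡⟨ ∑-cong cells (λ h → sym (∑-*ˡ Ts (𝟙 (inRect R S h)) _)) ⟩
    ∑[ h ∈ cells ] ∑[ t ∈ Ts ] (𝟙 (inRect R S h) * (𝟙 (not (occurs h t)) * 𝟙 (occupies R S t)))
      ≡⟨ ∑-comm cells Ts _ ⟩
    ∑[ t ∈ Ts ] ∑[ h ∈ cells ] (𝟙 (inRect R S h) * (𝟙 (not (occurs h t)) * 𝟙 (occupies R S t)))
      ≡⟨ ∑-cong Ts (λ t → trans (∑-cong cells (λ h → sym (*-assoc (𝟙 (inRect R S h)) _ _)))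
                               (trans (∑-*ʳ cells (𝟙 (occupies R S t)) _) (free t))) ⟩
    ∑[ t ∈ Ts ] ((∣ R ∣ * ∣ S ∣ ∸ k) * 𝟙 (occupies R S t))
      ≡⟨ ∑-*ˡ Ts (∣ R ∣ * ∣ S ∣ ∸ k) _ ⟩
    (∣ R ∣ * ∣ S ∣ ∸ k) * placements k R S ∎
    where
    open ≡-Reasoning
    Ts = allVecs cells k
    free : ∀ t → ∑[ h ∈ cells ] (𝟙 (inRect R S h) * 𝟙 (not (occurs h t))) * 𝟙 (occupies R S t)
               ≡ (∣ R ∣ * ∣ S ∣ ∸ k) * 𝟙 (occupies R S t)
    free t with occupies R S t in e
    ... | false = trans (*-zeroʳ (∑[ h ∈ cells ] (𝟙 (inRect R S h) * 𝟙 (not (occurs h t))))) (sym (*-zeroʳ (∣ R ∣ * ∣ S ∣ ∸ k)))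
    ... | true with ∧-true {distinct t} e
    ...   | distinct-t , images with ∧-true {does (image proj₁ t ≟ˢ R)} images
    ...     | rows , cols = cong (_* 1) (trans (∑-fresh (inRect R S) t distinct-t inside)
                                               (cong (_∸ k) (∑-inRect R S)))
      where
      inside : ∀ h → occurs h t ≡ true → inRect R S h ≡ true
      inside h o = cong₂ _∧_
        (subst (λ B → lookup B (proj₁ h) ≡ true) (does≡true⇒ (image proj₁ t ≟ˢ R) rows) (occurs⇒lookup-image proj₁ h t o))
        (subst (λ B → lookup B (proj₂ h) ≡ true) (does≡true⇒ (image proj₂ t ≟ˢ S) cols) (occurs⇒lookup-image proj₂ h t o))

  placements-suc : ∀ k R S → placements (suc k) R S ≡ (∣ R ∣ * ∣ S ∣ ∸ k) * placements k R S
    + ∑[ h ∈ cells ] (𝟙 (inRect R S h) * (placements k R (remove (proj₂ h) S) + placements k (remove (proj₁ h) R) S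
                                            + placements k (remove (proj₁ h) R) (remove (proj₂ h) S)))
  placements-suc k R S = begin
    ∑ (allVecs cells (suc k)) (𝟙 ∘ occupies R S)
      ≡⟨ allVecs-suc cells k (𝟙 ∘ occupies R S) ⟩
    ∑[ h ∈ cells ] ∑[ t ∈ Ts ] 𝟙 (occupies R S (h ∷ᵥ t))
      ≡⟨ ∑-cong cells (λ h → trans (∑-cong Ts (occupies-∷ R S h)) (∑-*ˡ Ts (𝟙 (inRect R S h)) _)) ⟩
    ∑[ h ∈ cells ] (𝟙 (inRect R S h) * ∑[ t ∈ Ts ] (fresh h t + rest h t))
      ≡⟨ ∑-cong cells (λ h → trans (cong (𝟙 (inRect R S h) *_) (∑-+ Ts (fresh h) (rest h)))
                                  (*-distribˡ-+ (𝟙 (inRect R S h)) _ _)) ⟩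
    ∑[ h ∈ cells ] (𝟙 (inRect R S h) * ∑ Ts (fresh h) + 𝟙 (inRect R S h) * ∑ Ts (rest h))
      ≡⟨ ∑-+ cells _ _ ⟩
    ∑[ h ∈ cells ] (𝟙 (inRect R S h) * ∑ Ts (fresh h)) + ∑[ h ∈ cells ] (𝟙 (inRect R S h) * ∑ Ts (rest h))
      ≡⟨ cong₂ _+_ (∑-fresh-occupies k R S)
           (∑-cong cells (λ h → cong (𝟙 (inRect R S h) *_) (∑-+₃ Ts (𝟙 ∘ occupies R (S′ h)) (𝟙 ∘ occupies (R′ h) S) _))) ⟩
    (∣ R ∣ * ∣ S ∣ ∸ k) * placements k R S
      + ∑[ h ∈ cells ] (𝟙 (inRect R S h) * (placements k R (S′ h) + placements k (R′ h) S + placements k (R′ h) (S′ h))) ∎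
    where
    open ≡-Reasoning
    Ts = allVecs cells k
    R′ = λ (h : Cell x y) → remove (proj₁ h) R
    S′ = λ (h : Cell x y) → remove (proj₂ h) S
    fresh rest : Cell x y → Vec (Cell x y) k → ℕ
    fresh h t = 𝟙 (not (occurs h t)) * 𝟙 (occupies R S t)
    rest h t = 𝟙 (occupies R (S′ h) t) + 𝟙 (occupies (R′ h) S t) + 𝟙 (occupies (R′ h) (S′ h) t)
    ∑-+₃ : ∀ {A : Set} (L : List A) (f g e : A → ℕ) → ∑[ a ∈ L ] (f a + g a + e a) ≡ ∑ L f + ∑ L g + ∑ L e
    ∑-+₃ L f g e = trans (∑-+ L (λ a → f a + g a) e) (cong (_+ ∑ L e) (∑-+ L f g))

  placements≡tableCount : ∀ k R S → placements k R S ≡ tableCount k ∣ R ∣ ∣ S ∣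
  placements≡tableCount zero    R S = trans (+-identityʳ _) (cong 𝟙 (cong₂ _∧_ (⊥≟ˢ R) (⊥≟ˢ S)))
  placements≡tableCount (suc k) R S = begin
    placements (suc k) R S
      ≡⟨ placements-suc k R S ⟩
    (l * m ∸ k) * placements k R S
      + ∑[ h ∈ cells ] (𝟙 (inRect R S h) * (placements k R (S′ h) + placements k (R′ h) S + placements k (R′ h) (S′ h)))
      ≡⟨ cong₂ _+_ (cong ((l * m ∸ k) *_) (placements≡tableCount k R S)) (∑-cong cells shrink) ⟩
    (l * m ∸ k) * tableCount k l m + ∑[ h ∈ cells ] (𝟙 (inRect R S h) * E)
      ≡⟨ cong ((l * m ∸ k) * tableCount k l m +_) (trans (∑-*ʳ cells E (𝟙 ∘ inRect R S)) (cong (_* E) (∑-inRect R S))) ⟩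
    tableCount (suc k) l m ∎
    where
    open ≡-Reasoning
    l = ∣ R ∣
    m = ∣ S ∣
    R′ = λ (h : Cell x y) → remove (proj₁ h) R
    S′ = λ (h : Cell x y) → remove (proj₂ h) S
    E = tableCount k l (m ∸ 1) + tableCount k (l ∸ 1) m + tableCount k (l ∸ 1) (m ∸ 1)
    shrink : ∀ h → 𝟙 (inRect R S h) * (placements k R (S′ h) + placements k (R′ h) S + placements k (R′ h) (S′ h))
                 ≡ 𝟙 (inRect R S h) * E
    shrink (r , c) with lookup R r in r∈R | lookup S c in c∈S
    ... | false | _     = refl
    ... | true  | false = refl
    ... | true  | true  = cong (1 *_) (cong₂ _+_ (cong₂ _+_
          (trans (placements≡tableCount k R (S′ (r , c))) (cong (tableCount k l) ∣S′∣))
          (trans (placements≡tableCount k (R′ (r , c)) S) (cong (λ l′ → tableCount k l′ m) ∣R′∣)))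
          (trans (placements≡tableCount k (R′ (r , c)) (S′ (r , c))) (cong₂ (tableCount k) ∣R′∣ ∣S′∣)))
      where
      ∣R′∣ = cong (_∸ 1) (suc-∣remove∣ r R r∈R)
      ∣S′∣ = cong (_∸ 1) (suc-∣remove∣ c S c∈S)

  conjoint⇔occupies : ∀ k (v : Vec (Cell x y) k) → IsConjointTable k x y v ⇔ occupies ⊤ ⊤ v ≡ true
  conjoint⇔occupies k v = mk⇔ to from
    where
    rows = image≡⊤⇔surjective proj₁ v
    cols = image≡⊤⇔surjective proj₂ v
    to : IsConjointTable k x y v → occupies ⊤ ⊤ v ≡ true
    to (inj , rows-onto , cols-onto) = cong₂ _∧_ (Equivalence.from (distinct⇔injective v) inj)
      (cong₂ _∧_ (dec-true (image proj₁ v ≟ˢ ⊤) (Equivalence.from rows rows-onto))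
                 (dec-true (image proj₂ v ≟ˢ ⊤) (Equivalence.from cols cols-onto)))
    from : occupies ⊤ ⊤ v ≡ true → IsConjointTable k x y v
    from e with ∧-true {distinct v} e
    ... | distinct-v , images with ∧-true {does (image proj₁ v ≟ˢ ⊤)} images
    ...   | rows-⊤ , cols-⊤ = Equivalence.to (distinct⇔injective v) distinct-v
                             , Equivalence.to rows (does≡true⇒ (image proj₁ v ≟ˢ ⊤) rows-⊤)
                             , Equivalence.to cols (does≡true⇒ (image proj₂ v ≟ˢ ⊤) cols-⊤)

  fall-expansion : ∀ k → fall (x * y) k ≡ ∑[ R ∈ subsets x ] ∑[ S ∈ subsets y ] tableCount k ∣ R ∣ ∣ S ∣
  fall-expansion k = begin
    fall (x * y) k
      ≡⟨ ∑-distinct k ⟨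
    ∑[ t ∈ Ts ] 𝟙 (distinct t)
      ≡⟨ ∑-cong Ts classify ⟩
    ∑[ t ∈ Ts ] ∑[ R ∈ subsets x ] ∑[ S ∈ subsets y ] 𝟙 (occupies R S t)
      ≡⟨ ∑-comm Ts (subsets x) _ ⟩
    ∑[ R ∈ subsets x ] ∑[ t ∈ Ts ] ∑[ S ∈ subsets y ] 𝟙 (occupies R S t)
      ≡⟨ ∑-cong (subsets x) (λ R → ∑-comm Ts (subsets y) _) ⟩
    ∑[ R ∈ subsets x ] ∑[ S ∈ subsets y ] placements k R S
      ≡⟨ ∑-cong (subsets x) (λ R → ∑-cong (subsets y) (placements≡tableCount k R)) ⟩
    ∑[ R ∈ subsets x ] ∑[ S ∈ subsets y ] tableCount k ∣ R ∣ ∣ S ∣ ∎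
    where
    open ≡-Reasoning
    Ts = allVecs cells k
    classify : ∀ t → 𝟙 (distinct t) ≡ ∑[ R ∈ subsets x ] ∑[ S ∈ subsets y ] 𝟙 (occupies R S t)
    classify t = sym (begin
      ∑[ R ∈ subsets x ] ∑[ S ∈ subsets y ] 𝟙 (occupies R S t)
        ≡⟨ ∑-cong (subsets x) (λ R → trans (∑-cong (subsets y) (λ S → trans (𝟙-occupies R S t) (sym (*-assoc i (a R) (c S)))))
                                          (∑-*ˡ (subsets y) (i * a R) c)) ⟩
      ∑[ R ∈ subsets x ] (i * a R * ∑ (subsets y) c)
        ≡⟨ ∑-cong (subsets x) (λ R → trans (cong (i * a R *_) (∑-subsets-≟ˢ (image proj₂ t))) (*-identityʳ (i * a R))) ⟩
      ∑[ R ∈ subsets x ] (i * a R)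
        ≡⟨ trans (∑-*ˡ (subsets x) i a) (cong (i *_) (∑-subsets-≟ˢ (image proj₁ t))) ⟩
      i * 1
        ≡⟨ *-identityʳ i ⟩
      𝟙 (distinct t) ∎)
      where
      i = 𝟙 (distinct t)
      a = λ R → 𝟙 (does (image proj₁ t ≟ˢ R))
      c = λ S → 𝟙 (does (image proj₂ t ≟ˢ S))

numTables≡tableCount : ∀ k l m → numTables k l m ≡ tableCount k l m
numTables≡tableCount k l m = begin
  numTables k l m
    ≡⟨ length-filter (isConjointTable? k l m) (allVecs cells k) ⟩
  ∑[ v ∈ allVecs cells k ] 𝟙 (does (isConjointTable? k l m v))
    ≡⟨ ∑-cong (allVecs cells k) (λ v → cong 𝟙 (does≡ (isConjointTable? k l m v) (conjoint⇔occupies k v))) ⟩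
  placements k ⊤ ⊤
    ≡⟨ placements≡tableCount k ⊤ ⊤ ⟩
  tableCount k ∣ ⊤ {l} ∣ ∣ ⊤ {m} ∣
    ≡⟨ cong₂ (tableCount k) (∣⊤∣≡n l) (∣⊤∣≡n m) ⟩
  tableCount k l m ∎
  where
  open ≡-Reasoning
  open Grid l m

tableCount-no-rows : ∀ k m → tableCount (suc k) 0 m ≡ 0
tableCount-no-rows k m rewrite 0∸n≡0 k = refl

tableCount-no-columns : ∀ k l → tableCount (suc k) l 0 ≡ 0
tableCount-no-columns k l rewrite *-zeroʳ l | 0∸n≡0 k = refl

fall-binomial-expansion : ∀ k a b → a ≤ suc k → b ≤ suc k →
  fall (a * b) (suc k) ≡ ∑₁ (suc k) (λ i → ∑₁ (suc k) (λ j → tableCount (suc k) i j * ((a C i) * (b C j))))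
fall-binomial-expansion k a b a≤K b≤K = begin
  fall (a * b) K
    ≡⟨ Grid.fall-expansion a b K ⟩
  ∑[ R ∈ subsets a ] ∑[ S ∈ subsets b ] tableCount K ∣ R ∣ ∣ S ∣
    ≡⟨ ∑-cong (subsets a) (λ R → trans (∑-subsets-card b≤K (tableCount K ∣ R ∣))
                                      (cong (λ z → z + G ∣ R ∣) (tableCount-no-columns k ∣ R ∣))) ⟩
  ∑ (subsets a) (G ∘ ∣_∣)
    ≡⟨ ∑-subsets-card a≤K G ⟩
  G 0 + ∑₁ K (λ i → (a C i) * G i)
    ≡⟨ cong (_+ ∑₁ K (λ i → (a C i) * G i)) (∑₁-zero K _ (λ j →
         trans (cong ((b C suc j) *_) (tableCount-no-rows k (suc j))) (*-zeroʳ (b C suc j)))) ⟩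
  ∑₁ K (λ i → (a C i) * G i)
    ≡⟨ ∑₁-cong K (λ i → trans (sym (∑₁-*ˡ K (a C i) _)) (∑₁-cong K (λ j → rearrange (a C i) (b C j) (tableCount K i j)))) ⟩
  ∑₁ K (λ i → ∑₁ K (λ j → tableCount K i j * ((a C i) * (b C j)))) ∎
  where
  open ≡-Reasoning
  K = suc k
  G = λ i → ∑₁ K (λ j → (b C j) * tableCount K i j)
  rearrange : ∀ p q r → p * (q * r) ≡ r * (p * q)
  rearrange = solve-∀

-- Opened only now: with ℤ's prefix +_ in scope, ℕ sections such as (n +_) no longer parse.
open import Data.Integer using (+_)

sum1-cong : ∀ N {f g : ℕ → ℤ} → (∀ i → f i ≡ g i) → sum1 N f ≡ sum1 N g
sum1-cong zero    e = refl
sum1-cong (suc N) e = cong₂ ℤ._+_ (sum1-cong N e) (e (suc N))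

sum1-+ : ∀ N (f g : ℕ → ℤ) → sum1 N (λ i → f i ℤ.+ g i) ≡ sum1 N f ℤ.+ sum1 N g
sum1-+ zero    f g = refl
sum1-+ (suc N) f g = trans (cong (ℤ._+ (f (suc N) ℤ.+ g (suc N))) (sum1-+ N f g)) (ℤ+.interchange (sum1 N f) (sum1 N g) _ _)

sum1-- : ∀ N (f g : ℕ → ℤ) → sum1 N (λ i → f i ℤ.- g i) ≡ sum1 N f ℤ.- sum1 N g
sum1-- zero    f g = refl
sum1-- (suc N) f g = trans (cong (ℤ._+ (f (suc N) ℤ.- g (suc N))) (sum1-- N f g)) (interchange (sum1 N f) (sum1 N g) _ _)
  where
  interchange : ∀ p q r s → (p ℤ.- q) ℤ.+ (r ℤ.- s) ≡ (p ℤ.+ r) ℤ.- (q ℤ.+ s)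
  interchange = ℤSolver.solve-∀

sum1-*ʳ : ∀ N c (f : ℕ → ℤ) → sum1 N (λ i → f i ℤ.* c) ≡ sum1 N f ℤ.* c
sum1-*ʳ zero    c f = refl
sum1-*ʳ (suc N) c f = trans (cong (ℤ._+ f (suc N) ℤ.* c) (sum1-*ʳ N c f)) (sym (ℤₚ.*-distribʳ-+ c (sum1 N f) (f (suc N))))

sum1-comm : ∀ N M (f : ℕ → ℕ → ℤ) → sum1 N (λ i → sum1 M (λ j → f i j)) ≡ sum1 M (λ j → sum1 N (λ i → f i j))
sum1-comm zero    M f = sym (sum1-vanish M)
  where
  sum1-vanish : ∀ M → sum1 M (λ _ → + 0) ≡ + 0
  sum1-vanish zero    = refl
  sum1-vanish (suc M) = trans (ℤₚ.+-identityʳ _) (sum1-vanish M)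
sum1-comm (suc N) M f =
  trans (cong (ℤ._+ sum1 M (f (suc N))) (sum1-comm N M f)) (sym (sum1-+ M (λ j → sum1 N (λ i → f i j)) (f (suc N))))

sum1-zero : ∀ n (f : ℕ → ℤ) → (∀ j → 1 ≤ j → j ≤ n → f j ≡ + 0) → sum1 n f ≡ + 0
sum1-zero zero    f z = refl
sum1-zero (suc n) f z = cong₂ ℤ._+_ (sum1-zero n f (λ j 1≤j j≤n → z j 1≤j (m≤n⇒m≤1+n j≤n))) (z (suc n) (s≤s z≤n) ≤-refl)

sum1-trim : ∀ {n N} (f : ℕ → ℤ) → n ≤ N → (∀ j → n < j → f j ≡ + 0) → sum1 N f ≡ sum1 n f
sum1-trim {n} {N} f n≤N z = subst (λ M → sum1 M f ≡ sum1 n f) (m∸n+n≡m n≤N) (trim (N ∸ n))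
  where
  trim : ∀ d → sum1 (d + n) f ≡ sum1 n f
  trim zero    = refl
  trim (suc d) = trans (cong₂ ℤ._+_ (trim d) (z (suc (d + n)) (s≤s (m≤n+m n d)))) (ℤₚ.+-identityʳ (sum1 n f))

+-∑₁ : ∀ N (f : ℕ → ℕ) → + ∑₁ N f ≡ sum1 N (λ i → + f i)
+-∑₁ zero    f = refl
+-∑₁ (suc N) f = trans (ℤₚ.pos-+ (∑₁ N f) (f (suc N))) (cong (ℤ._+ + f (suc N)) (+-∑₁ N f))

-- The binomial coefficients are triangular: a C i vanishes for i > a and a C a = 1.
binomials-independent : ∀ k (d : ℕ → ℤ) → (∀ a → a ≤ k → sum1 k (λ i → d i ℤ.* + (a C i)) ≡ + 0) →
  ∀ i → 1 ≤ i → i ≤ k → d i ≡ + 0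
binomials-independent k d vanishes i 1≤i i≤k = below i≤k i 1≤i ≤-refl
  where
  below : ∀ {n} → n ≤ k → ∀ i → 1 ≤ i → i ≤ n → d i ≡ + 0
  below {zero}  _   (suc i) _ ()
  below {suc n} n<k i 1≤i i≤1+n with m≤n⇒m<n∨m≡n i≤1+n
  ... | inj₁ (s≤s i≤n) = below (<⇒≤ n<k) i 1≤i i≤n
  ... | inj₂ refl = begin
    d (suc n)                                            ≡⟨ ℤₚ.*-identityʳ (d (suc n)) ⟨
    d (suc n) ℤ.* + 1                                    ≡⟨ cong (λ z → d (suc n) ℤ.* + z) (nCn≡1 (suc n)) ⟨
    d (suc n) ℤ.* + (suc n C suc n)                       ≡⟨ ℤₚ.+-identityˡ _ ⟨
    + 0 ℤ.+ d (suc n) ℤ.* + (suc n C suc n)              ≡⟨ cong (ℤ._+ d (suc n) ℤ.* + (suc n C suc n)) lower-terms ⟨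
    sum1 (suc n) f                                       ≡⟨ sum1-trim f n<k upper-terms ⟨
    sum1 k f                                             ≡⟨ vanishes (suc n) n<k ⟩
    + 0                                                  ∎
    where
    open ≡-Reasoning
    f = λ j → d j ℤ.* + (suc n C j)
    lower-terms : sum1 n f ≡ + 0
    lower-terms = sum1-zero n f (λ j 1≤j j≤n → cong (ℤ._* + (suc n C j)) (below (<⇒≤ n<k) j 1≤j j≤n))
    upper-terms : ∀ j → suc n < j → f j ≡ + 0
    upper-terms j n<j = trans (cong (λ z → d j ℤ.* + z) (k>n⇒nCk≡0 n<j)) (ℤₚ.*-zeroʳ (d j))

binomialExpansion : ℕ → (ℕ → ℕ → ℤ) → ℕ → ℕ → ℤ
binomialExpansion k d a b = sum1 k (λ i → sum1 k (λ j → d i j ℤ.* (+ (a C i) ℤ.* + (b C j))))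

binomialExpansion-unique : ∀ k (d e : ℕ → ℕ → ℤ) →
  (∀ a b → a ≤ k → b ≤ k → binomialExpansion k d a b ≡ binomialExpansion k e a b) →
  ∀ i j → 1 ≤ i → i ≤ k → 1 ≤ j → j ≤ k → d i j ≡ e i j
binomialExpansion-unique k d e agree i j 1≤i i≤k 1≤j j≤k = ℤₚ.i-j≡0⇒i≡j (d i j) (e i j)
  (binomials-independent k (λ i′ → D i′ j)
    (λ a a≤k → binomials-independent k (λ j′ → sum1 k (λ i′ → D i′ j′ ℤ.* + (a C i′)))
      (λ b b≤k → trans (sym (difference a b)) (ℤₚ.i≡j⇒i-j≡0 (agree a b a≤k b≤k))) j 1≤j j≤k)
    i 1≤i i≤k)
  where
  D = λ i j → d i j ℤ.- e i j
  difference : ∀ a b → binomialExpansion k d a b ℤ.- binomialExpansion k e a b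
                     ≡ sum1 k (λ j → sum1 k (λ i → D i j ℤ.* + (a C i)) ℤ.* + (b C j))
  difference a b = begin
    binomialExpansion k d a b ℤ.- binomialExpansion k e a b
      ≡⟨ sum1-- k _ _ ⟨
    sum1 k (λ i → sum1 k (λ j → d i j ℤ.* ab i j) ℤ.- sum1 k (λ j → e i j ℤ.* ab i j))
      ≡⟨ sum1-cong k (λ i → trans (sym (sum1-- k _ _)) (sum1-cong k (λ j → distrib (d i j) (e i j) (ab i j)))) ⟩
    sum1 k (λ i → sum1 k (λ j → D i j ℤ.* ab i j))
      ≡⟨ sum1-comm k k _ ⟩
    sum1 k (λ j → sum1 k (λ i → D i j ℤ.* ab i j))
      ≡⟨ sum1-cong k (λ j → trans (sum1-cong k (λ i → sym (ℤₚ.*-assoc (D i j) _ _))) (sum1-*ʳ k (+ (b C j)) _)) ⟩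
    sum1 k (λ j → sum1 k (λ i → D i j ℤ.* + (a C i)) ℤ.* + (b C j)) ∎
    where
    open ≡-Reasoning
    ab = λ i j → + (a C i) ℤ.* + (b C j)
    distrib : ∀ p q r → p ℤ.* r ℤ.- q ℤ.* r ≡ (p ℤ.- q) ℤ.* r
    distrib = ℤSolver.solve-∀

+-fall-binomialExpansion : ∀ k a b → a ≤ suc k → b ≤ suc k →
  + fall (a * b) (suc k) ≡ binomialExpansion (suc k) (λ i j → + tableCount (suc k) i j) a b
+-fall-binomialExpansion k a b a≤K b≤K =
  trans (cong +_ (fall-binomial-expansion k a b a≤K b≤K))
  (trans (+-∑₁ (suc k) _) (sum1-cong (suc k) (λ i → trans (+-∑₁ (suc k) _) (sum1-cong (suc k) (λ j →
    trans (ℤₚ.pos-* (tableCount (suc k) i j) _) (cong (+ tableCount (suc k) i j ℤ.*_) (ℤₚ.pos-* (a C i) (b C j))))))))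

falling-to-binomial : ∀ k (c : ℕ → ℕ → ℤ) a b →
  sum1 k (λ i → sum1 k (λ j → c i j ℤ.* (+ fall a i ℤ.* + fall b j)))
    ≡ binomialExpansion k (λ i j → c i j ℤ.* + (i ! * j !)) a b
falling-to-binomial k c a b = sum1-cong k (λ i → sum1-cong k (rescale i))
  where
  rescale : ∀ i j → c i j ℤ.* (+ fall a i ℤ.* + fall b j) ≡ c i j ℤ.* + (i ! * j !) ℤ.* (+ (a C i) ℤ.* + (b C j))
  rescale i j = begin
    c i j ℤ.* (+ fall a i ℤ.* + fall b j)
      ≡⟨ cong₂ (λ p q → c i j ℤ.* (+ p ℤ.* + q)) (fall≡!*C a i) (fall≡!*C b j) ⟩
    c i j ℤ.* (+ (i ! * (a C i)) ℤ.* + (j ! * (b C j)))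
      ≡⟨ cong₂ (λ p q → c i j ℤ.* (p ℤ.* q)) (ℤₚ.pos-* (i !) (a C i)) (ℤₚ.pos-* (j !) (b C j)) ⟩
    c i j ℤ.* ((+ (i !) ℤ.* + (a C i)) ℤ.* (+ (j !) ℤ.* + (b C j)))
      ≡⟨ regroup (c i j) (+ (i !)) (+ (j !)) (+ (a C i)) (+ (b C j)) ⟩
    c i j ℤ.* (+ (i !) ℤ.* + (j !)) ℤ.* (+ (a C i) ℤ.* + (b C j))
      ≡⟨ cong (λ p → c i j ℤ.* p ℤ.* (+ (a C i) ℤ.* + (b C j))) (ℤₚ.pos-* (i !) (j !)) ⟨
    c i j ℤ.* + (i ! * j !) ℤ.* (+ (a C i) ℤ.* + (b C j)) ∎
    where
    open ≡-Reasoning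
    regroup : ∀ γ p q s t → γ ℤ.* ((p ℤ.* s) ℤ.* (q ℤ.* t)) ≡ γ ℤ.* (p ℤ.* q) ℤ.* (s ℤ.* t)
    regroup = ℤSolver.solve-∀

theorem2 : (k l m : ℕ) → 1 ≤ k → 1 ≤ l → l ≤ k → 1 ≤ m → m ≤ k →
    (c : ℕ → ℕ → ℤ) →
    (∀ (x y : ℕ) → + fall (x * y) k ≡ sum1 k (λ i → sum1 k (λ j → c i j ℤ.* (+ fall x i ℤ.* + fall y j)))) →
    + numTables k l m ≡ + ((l !) * (m !)) ℤ.* c l m
theorem2 zero    _ _ () _ _ _ _ _ _
theorem2 (suc k) l m _ 1≤l l≤K 1≤m m≤K c expansion = begin
  + numTables K l m         ≡⟨ cong +_ (numTables≡tableCount K l m) ⟩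
  + tableCount K l m        ≡⟨ binomialExpansion-unique K tables rescaled agree l m 1≤l l≤K 1≤m m≤K ⟩
  c l m ℤ.* + (l ! * m !)   ≡⟨ ℤₚ.*-comm (c l m) _ ⟩
  + (l ! * m !) ℤ.* c l m   ∎
  where
  open ≡-Reasoning
  K = suc k
  tables rescaled : ℕ → ℕ → ℤ
  tables i j = + tableCount K i j
  rescaled i j = c i j ℤ.* + (i ! * j !)
  agree : ∀ a b → a ≤ K → b ≤ K → binomialExpansion K tables a b ≡ binomialExpansion K rescaled a b
  agree a b a≤K b≤K = begin
    binomialExpansion K tables a b    ≡⟨ +-fall-binomialExpansion k a b a≤K b≤K ⟨
    + fall (a * b) K                  ≡⟨ expansion a b ⟩
    sum1 K (λ i → sum1 K (λ j → c i j ℤ.* (+ fall a i ℤ.* + fall b j)))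
                                      ≡⟨ falling-to-binomial K c a b ⟩
    binomialExpansion K rescaled a b  ∎
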